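{- Let $G=(V,E)$ be a graph, $k\ge 1$, and let $S\subseteq V$ with $|S|\le 4k$ be such that every connected component of $G-S$ is a clique or a tree. If a large-dense vertex $v\in V\setminus S$ lies in a tree component of $G-S$, then $(G,k)$ is a yes-instance of \textsc{Cliques or Trees Vertex Deletion} if and only if $(G-v,k-1)$ is a yes-instance.
   Context: Graphs are undirected, without self-loops, possibly with multi-edges (a pair of parallel edges forms a cycle). $N(v)$ is the neighbor set; $\rho(v)$ is the number of unordered pairs of neighbors of $v$ that are adjacent (parallel edges counted once). A vertex $v$ is large-dense if $|N(v)|>7k$ and $\rho(v)> |N(v)|(|N(v)|-1)/4$. A set is a clique if there is exactly one edge between any two distinct vertices, and a tree if it induces a connected acyclic graph. \textsc{Cliques or Trees Vertex Deletion}: given $(G,k)$, decide whether there is $X\subseteq V$ with $|X|\le k$ such that every component of $G-X$ is a clique or a tree. -}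

module Defs where

open import Data.Nat using (ℕ; zero; suc; _+_; _*_; _∸_; _≤_; _<_; _≟_)
open import Data.Fin using (Fin; zero; suc; punchIn; inject₁; fromℕ) renaming (_<_ to _<ᶠ_)
import Data.Fin as F
open import Data.Fin.Subset using (Subset; _∈_; _∉_; ∣_∣)
open import Data.Vec using (tabulate)
open import Data.Bool using (Bool; true; false; _∧_)
open import Data.List using (List; map)
open import Data.Nat.ListAction using (sum)
open import Data.List.Base using () renaming (allFin to allFinL)
open import Data.Product using (Σ; _×_; _,_)
open import Data.Sum using (_⊎_)
open import Relation.Nullary using (¬_; does)
open import Relation.Binary.PropositionalEquality using (_≡_; _≢_; sym; trans)
open import Function.Definitions using (Injective)
import Data.Nat.Properties as NP

-- A finite multigraph on vertex set Fin n, given by edge multiplicities.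
-- Undirected (symmetric), no self-loops; multi-edges allowed.
record Graph (n : ℕ) : Set where
  field
    mult     : Fin n → Fin n → ℕ
    symm     : ∀ u w → mult u w ≡ mult w u
    loopless : ∀ u → mult u u ≡ 0

open Graph public

Adj : ∀ {n} → Graph n → Fin n → Fin n → Set
Adj G u w = 1 ≤ mult G u w

adj? : ∀ {n} → Graph n → Fin n → Fin n → Bool
adj? G u w = does (1 NP.≤? mult G u w)

_−v_ : ∀ {n} → Graph (suc n) → Fin (suc n) → Graph n
mult     (G −v v) i j = mult G (punchIn v i) (punchIn v j)
symm     (G −v v) i j = symm G (punchIn v i) (punchIn v j)
loopless (G −v v) i   = loopless G (punchIn v i)

N : ∀ {n} → Graph n → Fin n → Subset n
N G v = tabulate (λ u → adj? G v u)

-- ρ(v): number of unordered pairs {a,b} of distinct neighbours of v that are adjacent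
-- (counted as ordered pairs with a < b; parallel edges counted once)
ρ : ∀ {n} → Graph n → Fin n → ℕ
ρ {n} G v = sum (map (λ a → sum (map (λ b → ind a b) (allFinL n))) (allFinL n))
  where
  ind : Fin n → Fin n → ℕ
  ind a b with does (a F.<? b) ∧ adj? G v a ∧ adj? G v b ∧ adj? G a b
  ... | true  = 1
  ... | false = 0

-- large-dense: |N(v)| > 7k and ρ(v) > |N(v)|(|N(v)|-1)/4   (written as 4ρ(v) > d(d-1))
LargeDense : ∀ {n} → Graph n → ℕ → Fin n → Set
LargeDense G k v = (7 * k < ∣ N G v ∣) × (∣ N G v ∣ * (∣ N G v ∣ ∸ 1) < 4 * ρ G v)

VSet : ℕ → Set₁
VSet n = Fin n → Set

data Reach {n} (G : Graph n) (P : VSet n) : Fin n → Fin n → Set where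
  here : ∀ {u} → P u → Reach G P u u
  step : ∀ {u w x} → P u → Adj G u w → Reach G P w x → Reach G P u x

Alive : ∀ {n} → Subset n → VSet n
Alive X u = u ∉ X

Component : ∀ {n} → Graph n → Subset n → Fin n → VSet n
Component G X u w = Reach G (Alive X) u w

IsClique : ∀ {n} → Graph n → VSet n → Set
IsClique G C = ∀ a b → C a → C b → a ≢ b → mult G a b ≡ 1

Connected : ∀ {n} → Graph n → VSet n → Set
Connected G C = ∀ a b → C a → C b → Reach G C a b

CycleIn : ∀ {n} → Graph n → VSet n → Set
CycleIn {n} G C =
  Σ ℕ λ l → Σ (Fin (3 + l) → Fin n) λ f →
    Injective _≡_ _≡_ f
    × (∀ i → C (f i))
    × (∀ (i : Fin (2 + l)) → Adj G (f (inject₁ i)) (f (suc i)))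
    × Adj G (f (fromℕ (2 + l))) (f zero)

-- G[C] acyclic: no pair of parallel edges (a 2-cycle) and no cycle of length ≥ 3
Acyclic : ∀ {n} → Graph n → VSet n → Set
Acyclic G C = (∀ a b → C a → C b → mult G a b ≤ 1) × ¬ CycleIn G C

IsTree : ∀ {n} → Graph n → VSet n → Set
IsTree G C = Connected G C × Acyclic G C

CliqueOrTreeModulator : ∀ {n} → Graph n → Subset n → Set
CliqueOrTreeModulator G X =
  ∀ u → u ∉ X → IsClique G (Component G X u) ⊎ IsTree G (Component G X u)

YesInstance : ∀ {n} → Graph n → ℕ → Set
YesInstance {n} G k = Σ (Subset n) λ X → ∣ X ∣ ≤ k × CliqueOrTreeModulator G X

{-# OPTIONS --safe #-}
module Submission where

-- A large-dense vertex v lies in every solution X with |X| ≤ k. Otherwise the component of v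
-- in G − X is a clique or a tree. If it is a clique: since |N(v)| > 7k ≥ |S| + |X| + 1, two
-- neighbours of v lie outside S ∪ X; they are adjacent, so with v they form a triangle in the
-- component of v in G − S, which is a tree. If it is a tree: every adjacent pair of neighbours
-- of v meets X, so ρ(v) ≤ |X|·|N(v)| ≤ k·|N(v)|, and |N(v)|(|N(v)| − 1) < 4ρ(v) then forces
-- |N(v)| ≤ 4k. Since v is in every solution, solutions of (G, k) and of (G − v, k − 1)
-- correspond by adding or removing v: each component of G − X is isomorphic, via punchIn v,
-- to a component of (G − v) − (X − v) and conversely.

open import Defs
open import Data.Nat using (ℕ; zero; suc; _+_; _*_; _∸_; _≤_; _<_; z≤n; s≤s)
open import Data.Nat.Properties
open import Data.Nat.ListAction using () renaming (sum to sumᴸ)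
open import Data.Fin using (Fin; zero; suc; punchIn; punchOut)
import Data.Fin as F
import Data.Fin.Properties as FP
open import Data.Fin.Subset using (Subset; _∈_; _∉_; ∣_∣)
open import Data.Fin.Subset.Properties using (_∈?_)
open import Data.Vec using ([]; _∷_; tabulate; insertAt; removeAt)
open import Data.Vec.Properties using (insertAt-punchIn; insertAt-lookup; insertAt-removeAt; []=⇒lookup; lookup⇒[]=)
open import Data.Bool using (true; false; if_then_else_; _∧_)
open import Data.List using (map)
import Data.List as List
open import Data.List.Properties using (map-tabulate)
open import Data.List.Base using () renaming (allFin to allFinL)
open import Data.Product using (Σ; ∃; ∃₂; _×_; _,_; proj₁; proj₂)
import Data.Product as Product
open import Data.Sum using (inj₁; inj₂)
import Data.Sum as Sum
open import Relation.Nullary using (¬_; Dec; does; yes; no; _×-dec_; ¬?; contradiction)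
open import Relation.Unary using (Decidable)
open import Relation.Binary.PropositionalEquality
open import Function using (_∘_; id)
open import Function.Definitions using (Injective)
open import Function.Bundles using (_⇔_; mk⇔; Equivalence)
open import Algebra.Properties.Semiring.Sum +-*-semiring
  using (sum; sum-syntax; sum-cong-≗; sum-remove; ∑-distrib-+; ∑-comm; *-distribˡ-sum; *-distribʳ-sum)

∑-mono-≤ : ∀ {n} {f g : Fin n → ℕ} → (∀ i → f i ≤ g i) → sum f ≤ sum g
∑-mono-≤ {zero}  _   = z≤n
∑-mono-≤ {suc n} f≤g = +-mono-≤ (f≤g zero) (∑-mono-≤ (f≤g ∘ suc))

sumᴸ-tabulate : ∀ {n} (f : Fin n → ℕ) → sumᴸ (List.tabulate f) ≡ sum f
sumᴸ-tabulate {zero}  f = refl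
sumᴸ-tabulate {suc n} f = cong (f zero +_) (sumᴸ-tabulate (f ∘ suc))

sumᴸ-map-allFin : ∀ {n} (f : Fin n → ℕ) → sumᴸ (map f (allFinL n)) ≡ sum f
sumᴸ-map-allFin f = trans (cong sumᴸ (map-tabulate id f)) (sumᴸ-tabulate f)

∑∑-product : ∀ {m n} (f : Fin m → ℕ) (g : Fin n → ℕ) →
             ∑[ a < m ] ∑[ b < n ] (f a * g b) ≡ sum f * sum g
∑∑-product {m} f g = begin
  ∑[ a < m ] ∑[ b < _ ] (f a * g b) ≡⟨ sum-cong-≗ (λ a → *-distribˡ-sum (f a) g) ⟨
  ∑[ a < m ] (f a * sum g)           ≡⟨ *-distribʳ-sum (sum g) f ⟨
  sum f * sum g                      ∎
  where open ≡-Reasoning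

𝟙 : ∀ {p} {P : Set p} → Dec P → ℕ
𝟙 P? = if does P? then 1 else 0

𝟙≤1 : ∀ {p} {P : Set p} (P? : Dec P) → 𝟙 P? ≤ 1
𝟙≤1 (yes _) = s≤s z≤n
𝟙≤1 (no _)  = z≤n

𝟙-cover : ∀ {a s x} {A : Set a} {S : Set s} {X : Set x} (A? : Dec A) (S? : Dec S) (X? : Dec X) →
          𝟙 A? ≤ 𝟙 S? + 𝟙 X? + 𝟙 (A? ×-dec ¬? S? ×-dec ¬? X?)
𝟙-cover (no _)  _       _       = z≤n
𝟙-cover (yes _) (yes _) _       = s≤s z≤n
𝟙-cover (yes _) (no _)  (yes _) = s≤s z≤n
𝟙-cover (yes _) (no _)  (no _)  = s≤s z≤n

𝟙-exclusive : ∀ {p q} {P : Set p} {Q : Set q} (P? : Dec P) (Q? : Dec Q) → (P → ¬ Q) → 𝟙 P? + 𝟙 Q? ≤ 1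
𝟙-exclusive (yes p) (yes q) p⇒¬q = contradiction q (p⇒¬q p)
𝟙-exclusive (yes _) (no _)  _    = s≤s z≤n
𝟙-exclusive (no _)  (yes _) _    = s≤s z≤n
𝟙-exclusive (no _)  (no _)  _    = z≤n

count : ∀ {n p} {P : Fin n → Set p} → Decidable P → ℕ
count {n} P? = ∑[ i < n ] 𝟙 (P? i)

1≤count⇒∃ : ∀ {n p} {P : Fin n → Set p} (P? : Decidable P) → 1 ≤ count P? → ∃ P
1≤count⇒∃ {zero}  P? ()
1≤count⇒∃ {suc n} P? h with P? zero
... | yes p = zero , p
... | no _  = Product.map suc id (1≤count⇒∃ (P? ∘ suc) h)

count≤1+count∘punchIn : ∀ {n p} {P : Fin (suc n) → Set p} (P? : Decidable P) i →
                        count P? ≤ 1 + count (P? ∘ punchIn i)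
count≤1+count∘punchIn P? i = begin
  count P?                             ≡⟨ sum-remove {i = i} (𝟙 ∘ P?) ⟩
  𝟙 (P? i) + count (P? ∘ punchIn i)    ≤⟨ +-monoˡ-≤ _ (𝟙≤1 (P? i)) ⟩
  1 + count (P? ∘ punchIn i)           ∎
  where open ≤-Reasoning

2≤count⇒∃₂ : ∀ {n p} {P : Fin n → Set p} (P? : Decidable P) → 2 ≤ count P? →
             ∃₂ λ i j → i ≢ j × P i × P j
2≤count⇒∃₂ {zero} P? ()
2≤count⇒∃₂ {suc n} P? h
  with i , pᵢ ← 1≤count⇒∃ P? (≤-trans (n≤1+n 1) h)
  with j , pⱼ ← 1≤count⇒∃ (P? ∘ punchIn i) (+-cancelˡ-≤ 1 1 _ (≤-trans h (count≤1+count∘punchIn P? i)))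
  = i , punchIn i j , FP.punchInᵢ≢i i j ∘ sym , pᵢ , pⱼ

∣p∣≡count : ∀ {n} (p : Subset n) → ∣ p ∣ ≡ count (_∈? p)
∣p∣≡count []          = refl
∣p∣≡count (true ∷ p)  = cong suc (∣p∣≡count p)
∣p∣≡count (false ∷ p) = ∣p∣≡count p

∣tabulate∣≡count : ∀ {n p} {P : Fin n → Set p} (P? : Decidable P) → ∣ tabulate (does ∘ P?) ∣ ≡ count P?
∣tabulate∣≡count {zero}  P? = refl
∣tabulate∣≡count {suc n} P? with P? zero
... | yes _ = cong suc (∣tabulate∣≡count (P? ∘ suc))
... | no _  = ∣tabulate∣≡count (P? ∘ suc)

∑∑-distrib-+ : ∀ {m n} (f g : Fin m → Fin n → ℕ) →
               ∑[ a < m ] ∑[ b < n ] (f a b + g a b) ≡ ∑[ a < m ] ∑[ b < n ] f a b + ∑[ a < m ] ∑[ b < n ] g a b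
∑∑-distrib-+ {m} {n} f g = trans (sum-cong-≗ (λ a → ∑-distrib-+ (f a) (g a)))
                                 (∑-distrib-+ (λ a → ∑[ b < n ] f a b) (λ a → ∑[ b < n ] g a b))

∑∑-ordered≤∑∑ : ∀ {n} (f : Fin n → Fin n → ℕ) →
                ∑[ a < n ] ∑[ b < n ] (𝟙 (a F.<? b) * (f a b + f b a)) ≤ ∑[ a < n ] ∑[ b < n ] f a b
∑∑-ordered≤∑∑ {n} f = begin
  ∑[ a < n ] ∑[ b < n ] (lt a b * (f a b + f b a))
    ≡⟨ sum-cong-≗ (λ a → sum-cong-≗ (λ b → *-distribˡ-+ (lt a b) (f a b) (f b a))) ⟩
  ∑[ a < n ] ∑[ b < n ] (lt a b * f a b + lt a b * f b a)
    ≡⟨ ∑∑-distrib-+ (λ a b → lt a b * f a b) (λ a b → lt a b * f b a) ⟩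
  ∑[ a < n ] ∑[ b < n ] (lt a b * f a b) + ∑[ a < n ] ∑[ b < n ] (lt a b * f b a)
    ≡⟨ cong (∑[ a < n ] ∑[ b < n ] (lt a b * f a b) +_) (∑-comm (λ a b → lt a b * f b a)) ⟩
  ∑[ a < n ] ∑[ b < n ] (lt a b * f a b) + ∑[ a < n ] ∑[ b < n ] (lt b a * f a b)
    ≡⟨ ∑∑-distrib-+ (λ a b → lt a b * f a b) (λ a b → lt b a * f a b) ⟨
  ∑[ a < n ] ∑[ b < n ] (lt a b * f a b + lt b a * f a b)
    ≡⟨ sum-cong-≗ (λ a → sum-cong-≗ (λ b → *-distribʳ-+ (f a b) (lt a b) (lt b a))) ⟨
  ∑[ a < n ] ∑[ b < n ] ((lt a b + lt b a) * f a b)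
    ≤⟨ ∑-mono-≤ (λ a → ∑-mono-≤ (λ b → *-monoˡ-≤ (f a b) (𝟙-exclusive (a F.<? b) (b F.<? a) FP.<-asym))) ⟩
  ∑[ a < n ] ∑[ b < n ] (1 * f a b)
    ≡⟨ sum-cong-≗ (λ a → sum-cong-≗ (λ b → *-identityˡ (f a b))) ⟩
  ∑[ a < n ] ∑[ b < n ] f a b
    ∎
  where
  open ≤-Reasoning
  lt : Fin n → Fin n → ℕ
  lt a b = 𝟙 (a F.<? b)

Adj? : ∀ {n} (G : Graph n) u w → Dec (Adj G u w)
Adj? G u w = 1 ≤? mult G u w

Adj-sym : ∀ {n} (G : Graph n) {u w} → Adj G u w → Adj G w u
Adj-sym G {u} {w} = subst (1 ≤_) (symm G u w)

Adj⇒≢ : ∀ {n} (G : Graph n) {u w} → Adj G u w → u ≢ w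
Adj⇒≢ G {u} uu refl with subst (1 ≤_) (loopless G u) uu
... | ()

Reach-start : ∀ {n} {G : Graph n} {P : VSet n} {u w} → Reach G P u w → P u
Reach-start (here p)     = p
Reach-start (step p _ _) = p

Reach-end : ∀ {n} {G : Graph n} {P : VSet n} {u w} → Reach G P u w → P w
Reach-end (here p)     = p
Reach-end (step _ _ r) = Reach-end r

triangle⇒CycleIn : ∀ {n} (G : Graph n) (C : VSet n) {u a b} → C u → C a → C b →
                   Adj G u a → Adj G a b → Adj G b u → CycleIn G C
triangle⇒CycleIn {n} G C {u} {a} {b} cu ca cb ua ab bu = 0 , corner , corner-injective , corner∈C , corner-adj , bu
  where
  corner : Fin 3 → Fin n
  corner zero             = u
  corner (suc zero)       = a
  corner (suc (suc zero)) = b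

  corner-injective : Injective _≡_ _≡_ corner
  corner-injective {zero}             {zero}             _ = refl
  corner-injective {zero}             {suc zero}         e = contradiction e (Adj⇒≢ G ua)
  corner-injective {zero}             {suc (suc zero)}   e = contradiction (sym e) (Adj⇒≢ G bu)
  corner-injective {suc zero}         {zero}             e = contradiction (sym e) (Adj⇒≢ G ua)
  corner-injective {suc zero}         {suc zero}         _ = refl
  corner-injective {suc zero}         {suc (suc zero)}   e = contradiction e (Adj⇒≢ G ab)
  corner-injective {suc (suc zero)}   {zero}             e = contradiction e (Adj⇒≢ G bu)
  corner-injective {suc (suc zero)}   {suc zero}         e = contradiction (sym e) (Adj⇒≢ G ab)
  corner-injective {suc (suc zero)}   {suc (suc zero)}   _ = refl

  corner∈C : ∀ i → C (corner i)
  corner∈C zero             = cu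
  corner∈C (suc zero)       = ca
  corner∈C (suc (suc zero)) = cb

  corner-adj : ∀ (i : Fin 2) → Adj G (corner (F.inject₁ i)) (corner (suc i))
  corner-adj zero       = ua
  corner-adj (suc zero) = ab

Adj⇒Component : ∀ {n} (G : Graph n) {X : Subset n} {v a} → v ∉ X → a ∉ X → Adj G v a → Component G X v a
Adj⇒Component G v∉X a∉X va = step v∉X va (here a∉X)

triangle-at⇒CycleIn : ∀ {n} (G : Graph n) {X : Subset n} {v a b} → v ∉ X → a ∉ X → b ∉ X →
                      Adj G v a → Adj G v b → Adj G a b → CycleIn G (Component G X v)
triangle-at⇒CycleIn G v∉X a∉X b∉X va vb ab =
  triangle⇒CycleIn G _ (here v∉X) (Adj⇒Component G v∉X a∉X va) (Adj⇒Component G v∉X b∉X vb)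
    va ab (Adj-sym G vb)

clique-degree-bound : ∀ {n} (G : Graph n) {S X : Subset n} {v} → v ∉ S → v ∉ X →
                      ¬ CycleIn G (Component G S v) → IsClique G (Component G X v) →
                      ∣ N G v ∣ ≤ suc (∣ S ∣ + ∣ X ∣)
clique-degree-bound {n} G {S} {X} {v} v∉S v∉X acyclic clique = begin
  ∣ N G v ∣
    ≡⟨ ∣tabulate∣≡count (Adj? G v) ⟩
  count (Adj? G v)
    ≤⟨ ∑-mono-≤ (λ a → 𝟙-cover (Adj? G v a) (a ∈? S) (a ∈? X)) ⟩
  ∑[ a < n ] (𝟙 (a ∈? S) + 𝟙 (a ∈? X) + 𝟙 (Fresh? a))
    ≡⟨ ∑-distrib-+ (λ a → 𝟙 (a ∈? S) + 𝟙 (a ∈? X)) (𝟙 ∘ Fresh?) ⟩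
  ∑[ a < n ] (𝟙 (a ∈? S) + 𝟙 (a ∈? X)) + count Fresh?
    ≡⟨ cong (_+ count Fresh?) (∑-distrib-+ (λ a → 𝟙 (a ∈? S)) (λ a → 𝟙 (a ∈? X))) ⟩
  count (_∈? S) + count (_∈? X) + count Fresh?
    ≡⟨ cong₂ (λ s x → s + x + count Fresh?) (∣p∣≡count S) (∣p∣≡count X) ⟨
  ∣ S ∣ + ∣ X ∣ + count Fresh?
    ≤⟨ +-monoʳ-≤ (∣ S ∣ + ∣ X ∣) at-most-one-fresh ⟩
  ∣ S ∣ + ∣ X ∣ + 1
    ≡⟨ +-comm _ 1 ⟩
  suc (∣ S ∣ + ∣ X ∣)
    ∎
  where
  open ≤-Reasoning
  Fresh? : Decidable (λ a → Adj G v a × a ∉ S × a ∉ X)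
  Fresh? a = Adj? G v a ×-dec ¬? (a ∈? S) ×-dec ¬? (a ∈? X)

  at-most-one-fresh : count Fresh? ≤ 1
  at-most-one-fresh with 2 ≤? count Fresh?
  ... | no ≱2 = ≤-pred (≰⇒> ≱2)
  ... | yes ≥2 with a , b , a≢b , (va , a∉S , a∉X) , (vb , b∉S , b∉X) ← 2≤count⇒∃₂ Fresh? ≥2 =
    contradiction (triangle-at⇒CycleIn G v∉S a∉S b∉S va vb ab) acyclic
    where
    ab : Adj G a b
    ab = ≤-reflexive (sym (clique a b (Adj⇒Component G v∉X a∉X va) (Adj⇒Component G v∉X b∉X vb) a≢b))

-- The summand of ρ is local to its definition; this exposes it.
ρ-summand : ∀ {n} (G : Graph n) (v : Fin n) → Σ (Fin n → Fin n → ℕ) λ ind →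
            ρ G v ≡ sumᴸ (map (λ a → sumᴸ (map (ind a) (allFinL n))) (allFinL n))
ρ-summand G v = _ , refl

ρ≡∑∑ : ∀ {n} (G : Graph n) v →
       ρ G v ≡ ∑[ a < n ] ∑[ b < n ] 𝟙 (a F.<? b ×-dec Adj? G v a ×-dec Adj? G v b ×-dec Adj? G a b)
ρ≡∑∑ {n} G v = begin
  ρ G v                                                   ≡⟨ proj₂ (ρ-summand G v) ⟩
  sumᴸ (map (λ a → sumᴸ (map (ind a) (allFinL n))) (allFinL n))
                                                          ≡⟨ sumᴸ-map-allFin (λ a → sumᴸ (map (ind a) (allFinL n))) ⟩
  ∑[ a < n ] sumᴸ (map (ind a) (allFinL n))               ≡⟨ sum-cong-≗ (λ a → sumᴸ-map-allFin (ind a)) ⟩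
  ∑[ a < n ] ∑[ b < n ] ind a b                           ≡⟨ sum-cong-≗ (λ a → sum-cong-≗ (ind≡𝟙 a)) ⟩
  ∑[ a < n ] ∑[ b < n ] 𝟙 (a F.<? b ×-dec Adj? G v a ×-dec Adj? G v b ×-dec Adj? G a b) ∎
  where
  open ≡-Reasoning
  ind : Fin n → Fin n → ℕ
  ind = proj₁ (ρ-summand G v)

  ind≡𝟙 : ∀ a b → ind a b ≡ 𝟙 (a F.<? b ×-dec Adj? G v a ×-dec Adj? G v b ×-dec Adj? G a b)
  ind≡𝟙 a b with does (a F.<? b) ∧ adj? G v a ∧ adj? G v b ∧ adj? G a b
  ... | true  = refl
  ... | false = refl

-- Each adjacent pair a < b of neighbours is charged to one of its vertices in X. Charging it once
-- rather than once per orientation (∑∑-ordered≤∑∑) matters: a factor 2 would only give |N(v)| ≤ 8k.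
acyclic-ρ-bound : ∀ {n} (G : Graph n) {X : Subset n} {v} → v ∉ X → ¬ CycleIn G (Component G X v) →
                  ρ G v ≤ ∣ X ∣ * ∣ N G v ∣
acyclic-ρ-bound {n} G {X} {v} v∉X acyclic = begin
  ρ G v
    ≡⟨ ρ≡∑∑ G v ⟩
  ∑[ a < n ] ∑[ b < n ] 𝟙 (a F.<? b ×-dec Adj? G v a ×-dec Adj? G v b ×-dec Adj? G a b)
    ≤⟨ ∑-mono-≤ (λ a → ∑-mono-≤ (λ b → summand≤ (a F.<? b) (Adj? G v a) (Adj? G v b) (Adj? G a b))) ⟩
  ∑[ a < n ] ∑[ b < n ] (𝟙 (a F.<? b) * (f a b + f b a))
    ≤⟨ ∑∑-ordered≤∑∑ f ⟩
  ∑[ a < n ] ∑[ b < n ] f a b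
    ≡⟨ ∑∑-product (λ a → 𝟙 (a ∈? X)) (𝟙 ∘ Adj? G v) ⟩
  count (_∈? X) * count (Adj? G v)
    ≡⟨ cong₂ _*_ (∣p∣≡count X) (∣tabulate∣≡count (Adj? G v)) ⟨
  ∣ X ∣ * ∣ N G v ∣
    ∎
  where
  open ≤-Reasoning
  f : Fin n → Fin n → ℕ
  f a b = 𝟙 (a ∈? X) * 𝟙 (Adj? G v b)

  summand≤ : ∀ {a b} (a<b? : Dec (a F.< b)) (va? : Dec (Adj G v a)) (vb? : Dec (Adj G v b)) (ab? : Dec (Adj G a b)) →
             𝟙 (a<b? ×-dec va? ×-dec vb? ×-dec ab?) ≤ 𝟙 a<b? * (𝟙 (a ∈? X) * 𝟙 vb? + 𝟙 (b ∈? X) * 𝟙 va?)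
  summand≤ (no _)  _        _        _        = z≤n
  summand≤ (yes _) (no _)   _        _        = z≤n
  summand≤ (yes _) (yes _)  (no _)   _        = z≤n
  summand≤ (yes _) (yes _)  (yes _)  (no _)   = z≤n
  summand≤ {a} {b} (yes _) (yes va) (yes vb) (yes ab) with a ∈? X | b ∈? X
  ... | yes _   | _       = s≤s z≤n
  ... | no _    | yes _   = s≤s z≤n
  ... | no a∉X  | no b∉X  = contradiction (triangle-at⇒CycleIn G v∉X a∉X b∉X va vb ab) acyclic

quadratic-bound : ∀ d m → d * (d ∸ 1) < 4 * (m * d) → d ≤ 4 * m
quadratic-bound zero    m _ = z≤n
quadratic-bound (suc d) m h = *-cancelʳ-< (suc d) d (4 * m) (begin-strict
  d * suc d        ≡⟨ *-comm d (suc d) ⟩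
  suc d * d        <⟨ h ⟩
  4 * (m * suc d)  ≡⟨ *-assoc 4 m (suc d) ⟨
  4 * m * suc d    ∎)
  where open ≤-Reasoning

large-dense-vertex∈solution : ∀ {n} (G : Graph n) {k} {S X : Subset n} {v} → 1 ≤ k → ∣ S ∣ ≤ 4 * k → v ∉ S →
                              ¬ CycleIn G (Component G S v) → LargeDense G k v →
                              ∣ X ∣ ≤ k → CliqueOrTreeModulator G X → v ∈ X
large-dense-vertex∈solution G {k} {S} {X} {v} 1≤k |S|≤4k v∉S acyclic (7k<d , dense) |X|≤k modX
  with v ∈? X
... | yes v∈X = v∈X
... | no v∉X  = contradiction degree≤7k (<⇒≱ 7k<d)
  where
  degree≤7k : ∣ N G v ∣ ≤ 7 * k
  degree≤7k with modX v v∉X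
  ... | inj₁ clique = begin
    ∣ N G v ∣             ≤⟨ clique-degree-bound G v∉S v∉X acyclic clique ⟩
    1 + (∣ S ∣ + ∣ X ∣)   ≤⟨ +-mono-≤ 1≤k (+-mono-≤ |S|≤4k |X|≤k) ⟩
    k + (4 * k + k)       ≡⟨ cong (k +_) (+-comm (4 * k) k) ⟩
    6 * k                 ≤⟨ *-monoˡ-≤ k (n≤1+n 6) ⟩
    7 * k                 ∎
    where open ≤-Reasoning
  ... | inj₂ (_ , _ , acyclicX) = begin
    ∣ N G v ∣  ≤⟨ quadratic-bound ∣ N G v ∣ k (<-≤-trans dense (*-monoʳ-≤ 4 ρ≤kd)) ⟩
    4 * k      ≤⟨ *-monoˡ-≤ k (m≤m+n 4 3) ⟩
    7 * k      ∎
    where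
    open ≤-Reasoning
    ρ≤kd : ρ G v ≤ k * ∣ N G v ∣
    ρ≤kd = ≤-trans (acyclic-ρ-bound G v∉X acyclicX) (*-monoˡ-≤ ∣ N G v ∣ |X|≤k)

record InducedIso {m n} (H : Graph n) (P : VSet n) (G : Graph m) (Q : VSet m) : Set where
  field
    ι         : Fin n → Fin m
    injective : ∀ {a b} → ι a ≡ ι b → a ≡ b
    mult-ι    : ∀ a b → mult G (ι a) (ι b) ≡ mult H a b
    forth     : ∀ {a} → P a → Q (ι a)
    back      : ∀ {a} → Q (ι a) → P a
    onto      : ∀ {w} → Q w → ∃ λ a → ι a ≡ w

module _ {m n} {H : Graph n} {P : VSet n} {G : Graph m} {Q : VSet m} (I : InducedIso H P G Q) where
  open InducedIso I

  Adj-ι : ∀ {a b} → Adj H a b → Adj G (ι a) (ι b)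
  Adj-ι {a} {b} = subst (1 ≤_) (sym (mult-ι a b))

  Adj-ι⁻ : ∀ {a b} → Adj G (ι a) (ι b) → Adj H a b
  Adj-ι⁻ {a} {b} = subst (1 ≤_) (mult-ι a b)

  pair-onto : ∀ {R : Fin m → Fin m → Set} → (∀ {a b} → P a → P b → R (ι a) (ι b)) →
              ∀ {u w} → Q u → Q w → R u w
  pair-onto h qu qw with onto qu | onto qw
  ... | _ , refl | _ , refl = h (back qu) (back qw)

  Reach-ι : ∀ {a b} → Reach H P a b → Reach G Q (ι a) (ι b)
  Reach-ι (here p)       = here (forth p)
  Reach-ι (step p ab r)  = step (forth p) (Adj-ι ab) (Reach-ι r)

  Reach-ι⁻ : ∀ {a b} → Reach G Q (ι a) (ι b) → Reach H P a b
  Reach-ι⁻ = pull refl refl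
    where
    pull : ∀ {a b u w} → ι a ≡ u → ι b ≡ w → Reach G Q u w → Reach H P a b
    pull refl ιb≡ιa (here q) with injective ιb≡ιa
    ... | refl = here (back q)
    pull refl ιb≡w (step q uw r) with onto (Reach-start r)
    ... | _ , refl = step (back q) (Adj-ι⁻ uw) (pull refl ιb≡w r)

  CycleIn-ι : CycleIn H P → CycleIn G Q
  CycleIn-ι (l , f , f-injective , f∈P , f-adj , f-closes) =
    l , ι ∘ f , f-injective ∘ injective , forth ∘ f∈P , Adj-ι ∘ f-adj , Adj-ι f-closes

  CycleIn-ι⁻ : CycleIn G Q → CycleIn H P
  CycleIn-ι⁻ (l , f , f-injective , f∈Q , f-adj , f-closes) =
    l , g , g-injective , g∈P , Adj-back ∘ f-adj , Adj-back f-closes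
    where
    g : Fin (3 + l) → Fin n
    g i = proj₁ (onto (f∈Q i))
    ιg≡f : ∀ i → ι (g i) ≡ f i
    ιg≡f i = proj₂ (onto (f∈Q i))
    g-injective : Injective _≡_ _≡_ g
    g-injective {i} {j} gi≡gj = f-injective (trans (sym (ιg≡f i)) (trans (cong ι gi≡gj) (ιg≡f j)))
    g∈P : ∀ i → P (g i)
    g∈P i = back (subst Q (sym (ιg≡f i)) (f∈Q i))
    Adj-back : ∀ {i j} → Adj G (f i) (f j) → Adj H (g i) (g j)
    Adj-back {i} {j} = Adj-ι⁻ ∘ subst₂ (Adj G) (sym (ιg≡f i)) (sym (ιg≡f j))

  IsClique-ι⁻ : IsClique G Q → IsClique H P
  IsClique-ι⁻ clique a b pa pb a≢b =
    trans (sym (mult-ι a b)) (clique (ι a) (ι b) (forth pa) (forth pb) (a≢b ∘ injective))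

  IsClique-ι : IsClique H P → IsClique G Q
  IsClique-ι clique u w = pair-onto {R = λ u w → u ≢ w → mult G u w ≡ 1}
    (λ {a} {b} pa pb ιa≢ιb → trans (mult-ι a b) (clique a b pa pb (ιa≢ιb ∘ cong ι)))

  IsTree-ι⁻ : IsTree G Q → IsTree H P
  IsTree-ι⁻ (connected , simple , acyclic) =
    (λ a b pa pb → Reach-ι⁻ (connected (ι a) (ι b) (forth pa) (forth pb))) ,
    (λ a b pa pb → subst (_≤ 1) (mult-ι a b) (simple (ι a) (ι b) (forth pa) (forth pb))) ,
    acyclic ∘ CycleIn-ι

  IsTree-ι : IsTree H P → IsTree G Q
  IsTree-ι (connected , simple , acyclic) =
    (λ u w → pair-onto {R = Reach G Q} (λ {a} {b} pa pb → Reach-ι (connected a b pa pb))) ,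
    (λ u w → pair-onto {R = λ u w → mult G u w ≤ 1}
      (λ {a} {b} pa pb → subst (_≤ 1) (sym (mult-ι a b)) (simple a b pa pb))) ,
    acyclic ∘ CycleIn-ι⁻

component-iso : ∀ {m n} {H : Graph n} {G : Graph m} {X′ : Subset n} {X : Subset m}
                (I : InducedIso H (Alive X′) G (Alive X)) (u : Fin n) →
                InducedIso H (Component H X′ u) G (Component G X (InducedIso.ι I u))
component-iso I u = record
  { ι = ι ; injective = injective ; mult-ι = mult-ι
  ; forth = Reach-ι I ; back = Reach-ι⁻ I ; onto = onto ∘ Reach-end }
  where open InducedIso I

modulator-ι : ∀ {m n} {H : Graph n} {G : Graph m} {X′ : Subset n} {X : Subset m} →
              InducedIso H (Alive X′) G (Alive X) → CliqueOrTreeModulator G X ⇔ CliqueOrTreeModulator H X′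
modulator-ι {H = H} {G} {X′} {X} I = mk⇔ to from
  where
  open InducedIso I
  to : CliqueOrTreeModulator G X → CliqueOrTreeModulator H X′
  to mod u u∉X′ = Sum.map (IsClique-ι⁻ (component-iso I u)) (IsTree-ι⁻ (component-iso I u)) (mod (ι u) (forth u∉X′))
  from : CliqueOrTreeModulator H X′ → CliqueOrTreeModulator G X
  from mod w w∉X with onto w∉X
  ... | u , refl = Sum.map (IsClique-ι (component-iso I u)) (IsTree-ι (component-iso I u)) (mod u (back w∉X))

deletion-iso : ∀ {n} (G : Graph (suc n)) (v : Fin (suc n)) (X′ : Subset n) →
               InducedIso (G −v v) (Alive X′) G (Alive (insertAt X′ v true))
deletion-iso G v X′ = record
  { ι = punchIn v ; injective = FP.punchIn-injective v _ _ ; mult-ι = λ _ _ → refl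
  ; forth = λ a∉X′ → a∉X′ ∘ punchIn∈⁻ ; back = λ ιa∉X → ιa∉X ∘ punchIn∈
  ; onto = λ w∉X → punchOut (v≢ w∉X) , FP.punchIn-punchOut (v≢ w∉X) }
  where
  X : Subset (suc _)
  X = insertAt X′ v true
  punchIn∈ : ∀ {a} → a ∈ X′ → punchIn v a ∈ X
  punchIn∈ {a} a∈X′ = lookup⇒[]= (punchIn v a) X (trans (insertAt-punchIn X′ v true a) ([]=⇒lookup a∈X′))
  punchIn∈⁻ : ∀ {a} → punchIn v a ∈ X → a ∈ X′
  punchIn∈⁻ {a} ιa∈X = lookup⇒[]= a X′ (trans (sym (insertAt-punchIn X′ v true a)) ([]=⇒lookup ιa∈X))
  v≢ : ∀ {w} → w ∉ X → v ≢ w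
  v≢ w∉X refl = w∉X (lookup⇒[]= v X (insertAt-lookup X′ v true))

∣insertAt∣ : ∀ {n} (p : Subset n) i → ∣ insertAt p i true ∣ ≡ suc ∣ p ∣
∣insertAt∣ p           zero    = refl
∣insertAt∣ (true ∷ p)  (suc i) = cong suc (∣insertAt∣ p i)
∣insertAt∣ (false ∷ p) (suc i) = ∣insertAt∣ p i

insertAt-removeAt-∈ : ∀ {n} {X : Subset (suc n)} {v} → v ∈ X → insertAt (removeAt X v) v true ≡ X
insertAt-removeAt-∈ {X = X} {v} v∈X =
  subst (λ b → insertAt (removeAt X v) v b ≡ X) ([]=⇒lookup v∈X) (insertAt-removeAt X v)

solution-after-deletion : ∀ {n} {G : Graph (suc n)} {k} {v} {X : Subset (suc n)} → v ∈ X →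
                          ∣ X ∣ ≤ k → CliqueOrTreeModulator G X → YesInstance (G −v v) (k ∸ 1)
solution-after-deletion {G = G} {k} {v} {X} v∈X |X|≤k modX =
  X′ , ∸-monoˡ-≤ 1 (subst (_≤ k) X≡ |X|≤k) , Equivalence.to (modulator-ι (deletion-iso G v X′)) modX′
  where
  X′ : Subset _
  X′ = removeAt X v
  X≡ : ∣ X ∣ ≡ suc ∣ X′ ∣
  X≡ = trans (cong ∣_∣ (sym (insertAt-removeAt-∈ v∈X))) (∣insertAt∣ X′ v)
  modX′ : CliqueOrTreeModulator G (insertAt X′ v true)
  modX′ = subst (CliqueOrTreeModulator G) (sym (insertAt-removeAt-∈ v∈X)) modX

solution-before-deletion : ∀ {n} {G : Graph (suc n)} {k} (v : Fin (suc n)) → 1 ≤ k →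
                           YesInstance (G −v v) (k ∸ 1) → YesInstance G k
solution-before-deletion {G = G} v (s≤s z≤n) (X′ , |X′|≤k , modX′) =
  insertAt X′ v true , subst (_≤ _) (sym (∣insertAt∣ X′ v)) (s≤s |X′|≤k) ,
  Equivalence.from (modulator-ι (deletion-iso G v X′)) modX′

lemma13 : ∀ {n} (G : Graph (suc n)) (k : ℕ) (S : Subset (suc n)) (v : Fin (suc n))
          → 1 ≤ k
          → ∣ S ∣ ≤ 4 * k
          → CliqueOrTreeModulator G S
          → LargeDense G k v
          → v ∉ S
          → IsTree G (Component G S v)
          → YesInstance G k ⇔ YesInstance (G −v v) (k ∸ 1)
lemma13 G k S v 1≤k |S|≤4k _ large-dense v∉S (_ , _ , acyclic) = mk⇔
  (λ (X , |X|≤k , modX) → solution-after-deletion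
    (large-dense-vertex∈solution G 1≤k |S|≤4k v∉S acyclic large-dense |X|≤k modX) |X|≤k modX)
  (solution-before-deletion v 1≤k)
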